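{- For every even integer $m\geq 2$ and every integer $n\geq 2$, $b(K_m \times P_n) = n\cdot\frac{m^2}{4}$.
   Context: For a finite simple graph $G$, the brush number $b(G)$ is the minimum, over all acyclic orientations of the edges of $G$, of $\sum_{v\in V(G)} \max\{0,d^+(v)-d^-(v)\}$, where $d^+(v)$ and $d^-(v)$ are the outdegree and indegree of $v$ in the orientation (equivalently, the minimum number of brushes needed to clean $G$ in the graph cleaning process). $K_m$ is the complete graph on $m$ vertices and $P_n$ is the path on $n$ vertices. The cartesian product $G\times H$ has vertex set $V(G)\times V(H)$, with $(a,b)$ adjacent to $(c,d)$ iff either $a=c$ and $bd\in E(H)$, or $ac\in E(G)$ and $b=d$. -}

module Defs where

open import Data.Nat using (ℕ; zero; suc; _+_; _*_; _∸_; _≤_)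
open import Data.Nat.Properties using (_≟_)
open import Data.Fin using (Fin; toℕ; remQuot)
import Data.Fin.Properties as FinP
open import Data.Bool using (Bool; true; false; not; _∧_; _∨_; if_then_else_)
open import Data.Product using (_×_; _,_; proj₁; proj₂; Σ)
open import Data.Sum using (_⊎_)
open import Relation.Nullary using (¬_)
open import Relation.Nullary.Decidable using (⌊_⌋)
open import Relation.Binary.PropositionalEquality using (_≡_; refl; cong; cong₂; trans; sym)
open import Data.Bool.Properties using (∨-comm; ∧-zeroʳ)
open import Relation.Nullary.Decidable using (dec-false)
open import Data.Nat.Properties using (1+n≢n)

record Graph : Set where
  field
    N      : ℕ
    adj    : Fin N → Fin N → Bool
    adj-sym : ∀ u v → adj u v ≡ adj v u
    irrefl : ∀ v → adj v v ≡ false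
open Graph public

sumFin : (n : ℕ) → (Fin n → ℕ) → ℕ
sumFin zero    f = 0
sumFin (suc n) f = f Fin.zero + sumFin n (λ i → f (Fin.suc i))
  where import Data.Fin as Fin

record Orientation (G : Graph) : Set where
  field
    arc      : Fin (N G) → Fin (N G) → Bool
    arc-edge : ∀ u v → arc u v ≡ true → adj G u v ≡ true
    arc-tot  : ∀ u v → adj G u v ≡ true → (arc u v ≡ true) ⊎ (arc v u ≡ true)
    arc-anti : ∀ u v → arc u v ≡ true → arc v u ≡ false
open Orientation public

data DWalk {G : Graph} (o : Orientation G) : Fin (N G) → Fin (N G) → Set where
  step : ∀ {u v} → arc o u v ≡ true → DWalk o u v
  cons : ∀ {u w v} → arc o u w ≡ true → DWalk o w v → DWalk o u v

Acyclic : {G : Graph} → Orientation G → Set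
Acyclic {G} o = ∀ v → ¬ DWalk o v v

outdeg indeg : {G : Graph} → Orientation G → Fin (N G) → ℕ
outdeg {G} o v = sumFin (N G) (λ w → if arc o v w then 1 else 0)
indeg  {G} o v = sumFin (N G) (λ w → if arc o w v then 1 else 0)

-- Σ_v max{0, d⁺(v) − d⁻(v)}  (truncated subtraction in ℕ is exactly max{0,·}).
cost : {G : Graph} → Orientation G → ℕ
cost {G} o = sumFin (N G) (λ v → outdeg o v ∸ indeg o v)

IsBrushNumber : Graph → ℕ → Set
IsBrushNumber G k =
  Σ (Orientation G) (λ o → Acyclic o × cost o ≡ k)
  × (∀ (o : Orientation G) → Acyclic o → k ≤ cost o)

_==_ : {n : ℕ} → Fin n → Fin n → Bool
i == j = ⌊ i FinP.≟ j ⌋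

==-sym : {n : ℕ} (i j : Fin n) → (i == j) ≡ (j == i)
==-sym i j with i FinP.≟ j | j FinP.≟ i
... | Relation.Nullary.yes _ | Relation.Nullary.yes _ = refl
... | Relation.Nullary.no _  | Relation.Nullary.no _  = refl
... | Relation.Nullary.yes p | Relation.Nullary.no q  = Data.Empty.⊥-elim (q (sym p))
  where import Data.Empty
... | Relation.Nullary.no q  | Relation.Nullary.yes p = Data.Empty.⊥-elim (q (sym p))
  where import Data.Empty

==-refl : {n : ℕ} (i : Fin n) → (i == i) ≡ true
==-refl i with i FinP.≟ i
... | Relation.Nullary.yes _ = refl
... | Relation.Nullary.no q = Data.Empty.⊥-elim (q refl)
  where import Data.Empty

K : ℕ → Graph
K m = record
  { N = m
  ; adj = λ i j → not (i == j)
  ; adj-sym = λ i j → cong not (==-sym i j)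
  ; irrefl = λ i → cong not (==-refl i)
  }

pathAdj : {n : ℕ} → Fin n → Fin n → Bool
pathAdj i j = ⌊ suc (toℕ i) ≟ toℕ j ⌋ ∨ ⌊ suc (toℕ j) ≟ toℕ i ⌋

pathIrr : {n : ℕ} (i : Fin n) → pathAdj i i ≡ false
pathIrr i with suc (toℕ i) ≟ toℕ i
... | Relation.Nullary.yes p = Data.Empty.⊥-elim (1+n≢n p)
  where import Data.Empty
... | Relation.Nullary.no _ = refl

P : ℕ → Graph
P n = record
  { N = n
  ; adj = pathAdj
  ; adj-sym = λ i j → ∨-comm (⌊ suc (toℕ i) ≟ toℕ j ⌋) (⌊ suc (toℕ j) ≟ toℕ i ⌋)
  ; irrefl = pathIrr
  }

-- Cartesian product G × H on Fin (N G * N H); a vertex x corresponds to the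
-- pair remQuot (N H) x = (a , b) ∈ V(G) × V(H) (a bijection, inverse combine).
pairAdj : (G H : Graph) → Fin (N G) × Fin (N H) → Fin (N G) × Fin (N H) → Bool
pairAdj G H (a , b) (c , d) = ((a == c) ∧ adj H b d) ∨ (adj G a c ∧ (b == d))

prodAdj : (G H : Graph) → Fin (N G * N H) → Fin (N G * N H) → Bool
prodAdj G H x y = pairAdj G H (remQuot {N G} (N H) x) (remQuot {N G} (N H) y)

pairSym : (G H : Graph) (p q : Fin (N G) × Fin (N H)) → pairAdj G H p q ≡ pairAdj G H q p
pairSym G H (a , b) (c , d) =
  cong₂ _∨_ (cong₂ _∧_ (==-sym a c) (adj-sym H b d))
            (cong₂ _∧_ (adj-sym G a c) (==-sym b d))

pairIrr : (G H : Graph) (p : Fin (N G) × Fin (N H)) → pairAdj G H p p ≡ false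
pairIrr G H (a , b) rewrite irrefl H b | irrefl G a | ∧-zeroʳ (a == a) = refl

prodSym : (G H : Graph) (x y : Fin (N G * N H)) → prodAdj G H x y ≡ prodAdj G H y x
prodSym G H x y = pairSym G H (remQuot {N G} (N H) x) (remQuot {N G} (N H) y)

prodIrr : (G H : Graph) (x : Fin (N G * N H)) → prodAdj G H x x ≡ false
prodIrr G H x = pairIrr G H (remQuot {N G} (N H) x)

_□_ : Graph → Graph → Graph
G □ H = record
  { N = N G * N H
  ; adj = prodAdj G H
  ; adj-sym = prodSym G H
  ; irrefl = prodIrr G H
  }

-- Lower bound, by a cut argument.  For any orientation and any vertex set S,
-- the cost Σ_v max{0, d⁺ v − d⁻ v} is at least the number of arcs leaving S
-- minus the number of arcs entering S (cost-≥-cut).  In an acyclic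
-- orientation every layer K m is a transitive tournament; take for S the h
-- top-ranked vertices of every layer (CliqueRanking).  Inside a layer h·h arcs
-- leave S and none enters it; on the column edges between two adjacent layers
-- a counting lemma (Exchange) together with acyclicity shows that at least as
-- many arcs leave S as enter it (LowerBound).
--
-- Upper bound.  Orienting every edge towards the larger vertex index is
-- acyclic (indexOrientation); its degrees are explicit (IndexDegrees), and
-- summing the positive parts layer by layer gives exactly n·h² (UpperBound).
module Submission where

open import Defs
open import Data.Nat using (ℕ; zero; suc; _+_; _*_; _∸_; _/_; _≤_; _<_; z≤n; s≤s; _<ᵇ_; _≡ᵇ_; NonZero; >-nonZero)
open import Data.Nat.Divisibility using (_∣_; divides)
open import Data.Nat.Properties
open import Data.Nat.Tactic.RingSolver using (solve-∀)
open import Data.Nat.DivMod using (m*n/n≡m)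
open import Data.Fin as F using (Fin; toℕ; combine; remQuot)
import Data.Fin.Properties as FP
open import Data.Bool using (Bool; true; false; not; _∧_; _∨_; if_then_else_)
open import Data.Bool.Properties using (∧-zeroʳ; ∧-identityʳ; T-≡)
open import Data.Product using (_×_; _,_; proj₁; proj₂; ∃)
open import Data.Sum using (_⊎_; inj₁; inj₂)
open import Data.Empty using (⊥; ⊥-elim)
open import Function.Bundles using (Equivalence)
open import Relation.Nullary using (¬_; yes; no)
open import Relation.Nullary.Decidable using (isYes≗does)
open import Relation.Binary using (tri<; tri≈; tri>)
open import Relation.Binary.PropositionalEquality

-- Indicator of a Boolean.  It is chosen so that outdeg and indeg from Defs
-- are, definitionally, sums of indicators of arcs.
ind : Bool → ℕ
ind b = if b then 1 else 0

true≢false : ∀ {p : Bool} → p ≡ true → p ≡ false → ⊥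
true≢false refl ()

∧-true : ∀ p q → (p ∧ q) ≡ true → (p ≡ true) × (q ≡ true)
∧-true true true _ = refl , refl

not-true : ∀ p → not p ≡ true → p ≡ false
not-true false _ = refl

ind≤1 : ∀ b → ind b ≤ 1
ind≤1 true  = s≤s z≤n
ind≤1 false = z≤n

ind-true : ∀ p → ¬ ind p ≡ 0 → p ≡ true
ind-true true  _  = refl
ind-true false ne = ⊥-elim (ne refl)

ind-false : ∀ p → ¬ p ≡ true → ind p ≡ 0
ind-false true  ne = ⊥-elim (ne refl)
ind-false false _  = refl

ind-mono : ∀ p q → (p ≡ true → q ≡ true) → ind p ≤ ind q
ind-mono true  q f rewrite f refl = ≤-refl
ind-mono false q f = z≤n

ind-split : ∀ p q → ind p ≡ ind (p ∧ q) + ind (p ∧ not q)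
ind-split true  true  = refl
ind-split true  false = refl
ind-split false q     = refl

ind-not : ∀ p → ind p + ind (not p) ≡ 1
ind-not true  = refl
ind-not false = refl

<ᵇ-sound : ∀ a b → (a <ᵇ b) ≡ true → a < b
<ᵇ-sound a b e = <ᵇ⇒< a b (Equivalence.from T-≡ e)

<ᵇ-complete : ∀ {a b} → a < b → (a <ᵇ b) ≡ true
<ᵇ-complete a<b = Equivalence.to T-≡ (<⇒<ᵇ a<b)

<ᵇ-false : ∀ a b → b ≤ a → (a <ᵇ b) ≡ false
<ᵇ-false a       zero    _         = refl
<ᵇ-false (suc a) (suc b) (s≤s b≤a) = <ᵇ-false a b b≤a

<ᵇ-false-sound : ∀ a b → (a <ᵇ b) ≡ false → b ≤ a
<ᵇ-false-sound a b e with b ≤? a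
... | yes b≤a = b≤a
... | no  b≰a = ⊥-elim (true≢false (<ᵇ-complete (≰⇒> b≰a)) e)

≡ᵇ-sound : ∀ a b → (a ≡ᵇ b) ≡ true → a ≡ b
≡ᵇ-sound a b e = ≡ᵇ⇒≡ a b (Equivalence.from T-≡ e)

==-false : ∀ {k} (i j : Fin k) → ¬ i ≡ j → (i == j) ≡ false
==-false i j i≢j with i FP.≟ j
... | yes i≡j = ⊥-elim (i≢j i≡j)
... | no  _   = refl

<ᵇ-+ˡ : ∀ k x y → (k + x <ᵇ k + y) ≡ (x <ᵇ y)
<ᵇ-+ˡ zero    x y = refl
<ᵇ-+ˡ (suc k) x y = <ᵇ-+ˡ k x y

sum-cong : ∀ n {f g : Fin n → ℕ} → (∀ i → f i ≡ g i) → sumFin n f ≡ sumFin n g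
sum-cong zero    e = refl
sum-cong (suc n) e = cong₂ _+_ (e F.zero) (sum-cong n (λ i → e (F.suc i)))

sum-mono : ∀ n {f g : Fin n → ℕ} → (∀ i → f i ≤ g i) → sumFin n f ≤ sumFin n g
sum-mono zero    e = z≤n
sum-mono (suc n) e = +-mono-≤ (e F.zero) (sum-mono n (λ i → e (F.suc i)))

sum-strict : ∀ n (f g : Fin n → ℕ) j → (∀ i → f i ≤ g i) → f j < g j → sumFin n f < sumFin n g
sum-strict (suc n) f g F.zero    le lt = +-mono-<-≤ lt (sum-mono n (λ i → le (F.suc i)))
sum-strict (suc n) f g (F.suc j) le lt =
  +-mono-≤-< (le F.zero) (sum-strict n (λ i → f (F.suc i)) (λ i → g (F.suc i)) j (λ i → le (F.suc i)) lt)

private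
  interchange : ∀ a b c d → a + b + (c + d) ≡ a + c + (b + d)
  interchange = solve-∀

sum-+ : ∀ n (f g : Fin n → ℕ) → sumFin n (λ i → f i + g i) ≡ sumFin n f + sumFin n g
sum-+ zero    f g = refl
sum-+ (suc n) f g rewrite sum-+ n (λ i → f (F.suc i)) (λ i → g (F.suc i)) =
  interchange (f F.zero) (g F.zero) (sumFin n (λ i → f (F.suc i))) (sumFin n (λ i → g (F.suc i)))

sum-0 : ∀ n {f : Fin n → ℕ} → (∀ i → f i ≡ 0) → sumFin n f ≡ 0
sum-0 zero    e = refl
sum-0 (suc n) e rewrite e F.zero = sum-0 n (λ i → e (F.suc i))

sum-const : ∀ n k → sumFin n (λ _ → k) ≡ n * k
sum-const zero    k = refl
sum-const (suc n) k = cong (k +_) (sum-const n k)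

sum-1 : ∀ n → sumFin n (λ _ → 1) ≡ n
sum-1 n = trans (sum-const n 1) (*-identityʳ n)

sum-*ˡ : ∀ n k (f : Fin n → ℕ) → sumFin n (λ i → k * f i) ≡ k * sumFin n f
sum-*ˡ zero    k f = sym (*-zeroʳ k)
sum-*ˡ (suc n) k f =
  trans (cong (k * f F.zero +_) (sum-*ˡ n k (λ i → f (F.suc i)))) (sym (*-distribˡ-+ k (f F.zero) _))

sum-single : ∀ n (f : Fin n → ℕ) j → (∀ i → ¬ i ≡ j → f i ≡ 0) → sumFin n f ≡ f j
sum-single (suc n) f F.zero e =
  trans (cong (f F.zero +_) (sum-0 n (λ i → e (F.suc i) (λ ())))) (+-identityʳ _)
sum-single (suc n) f (F.suc j) e =
  trans (cong (_+ sumFin n (λ i → f (F.suc i))) (e F.zero (λ ())))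
        (sum-single n (λ i → f (F.suc i)) j (λ i ne → e (F.suc i) (λ eq → ne (FP.suc-injective eq))))

sum-swap : ∀ m n (f : Fin m → Fin n → ℕ) →
  sumFin m (λ i → sumFin n (λ j → f i j)) ≡ sumFin n (λ j → sumFin m (λ i → f i j))
sum-swap zero    n f = sym (sum-0 n (λ _ → refl))
sum-swap (suc m) n f =
  trans (cong (sumFin n (f F.zero) +_) (sum-swap m n (λ i → f (F.suc i))))
        (sym (sum-+ n (f F.zero) (λ j → sumFin m (λ i → f (F.suc i) j))))

sum-symmetric-≤ : ∀ n (f g : Fin n → Fin n → ℕ) → (∀ i j → f i j + f j i ≤ g i j + g j i) →
  sumFin n (λ i → sumFin n (f i)) ≤ sumFin n (λ i → sumFin n (g i))
sum-symmetric-≤ n f g pairwise = halve (begin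
    Σf + Σf                    ≡⟨ doubled f ⟩
    Σ² (λ i j → f i j + f j i) ≤⟨ sum-mono n (λ i → sum-mono n (pairwise i)) ⟩
    Σ² (λ i j → g i j + g j i) ≡⟨ sym (doubled g) ⟩
    Σg + Σg                    ∎)
  where
  open ≤-Reasoning
  Σ² : (Fin n → Fin n → ℕ) → ℕ
  Σ² h = sumFin n (λ i → sumFin n (h i))
  Σf Σg : ℕ
  Σf = Σ² f
  Σg = Σ² g
  doubled : ∀ h → Σ² h + Σ² h ≡ Σ² (λ i j → h i j + h j i)
  doubled h = trans (cong (Σ² h +_) (sum-swap n n h))
                    (trans (sym (sum-+ n _ _)) (sum-cong n (λ i → sym (sum-+ n _ _))))
  halve : Σf + Σf ≤ Σg + Σg → Σf ≤ Σg
  halve le with Σf ≤? Σg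
  ... | yes p = p
  ... | no np = ⊥-elim (<-irrefl refl (<-≤-trans (+-mono-< (≰⇒> np) (≰⇒> np)) le))

∸-subadditive : ∀ a b c d → (a + c) ∸ (b + d) ≤ (a ∸ b) + (c ∸ d)
∸-subadditive a b c d = m≤n+o⇒m∸n≤o (a + c) (b + d)
  (≤-trans (+-mono-≤ (m≤n+m∸n a b) (m≤n+m∸n c d)) (≤-reflexive (interchange b (a ∸ b) d (c ∸ d))))

sum-∸ : ∀ n (f g : Fin n → ℕ) → sumFin n f ∸ sumFin n g ≤ sumFin n (λ i → f i ∸ g i)
sum-∸ zero    f g = z≤n
sum-∸ (suc n) f g =
  ≤-trans (∸-subadditive (f F.zero) (g F.zero) (sumFin n (λ i → f (F.suc i))) (sumFin n (λ i → g (F.suc i))))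
          (+-monoʳ-≤ (f F.zero ∸ g F.zero) (sum-∸ n (λ i → f (F.suc i)) (λ i → g (F.suc i))))

sum-nonzero : ∀ n (f : Fin n → ℕ) → ¬ sumFin n f ≡ 0 → ∃ λ i → ¬ f i ≡ 0
sum-nonzero zero    f ne = ⊥-elim (ne refl)
sum-nonzero (suc n) f ne with f F.zero ≟ 0
... | no p  = F.zero , p
... | yes p with sum-nonzero n (λ i → f (F.suc i)) (λ q → ne (cong₂ _+_ p q))
... | i , q = F.suc i , q

sum-combine : ∀ m n (f : Fin (m * n) → ℕ) →
  sumFin (m * n) f ≡ sumFin m (λ a → sumFin n (λ b → f (combine a b)))
sum-combine zero    n f = refl
sum-combine (suc m) n f =
  trans (split n (m * n) f)
        (cong (sumFin n (λ j → f (j F.↑ˡ (m * n))) +_) (sum-combine m n (λ x → f (n F.↑ʳ x))))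
  where
  split : ∀ k l (g : Fin (k + l) → ℕ) →
    sumFin (k + l) g ≡ sumFin k (λ i → g (i F.↑ˡ l)) + sumFin l (λ j → g (k F.↑ʳ j))
  split zero    l g = refl
  split (suc k) l g = trans (cong (g F.zero +_) (split k l (λ i → g (F.suc i)))) (sym (+-assoc (g F.zero) _ _))

rsum : ℕ → (ℕ → ℕ) → ℕ
rsum zero    f = 0
rsum (suc k) f = rsum k f + f k

rsum-cong : ∀ k f g → (∀ j → j < k → f j ≡ g j) → rsum k f ≡ rsum k g
rsum-cong zero    f g e = refl
rsum-cong (suc k) f g e = cong₂ _+_ (rsum-cong k f g (λ j lt → e j (m<n⇒m<1+n lt))) (e k ≤-refl)

rsum-split : ∀ k l f → rsum (k + l) f ≡ rsum k f + rsum l (λ j → f (k + j))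
rsum-split k zero    f = trans (cong (λ z → rsum z f) (+-identityʳ k)) (sym (+-identityʳ _))
rsum-split k (suc l) f = trans (cong (λ z → rsum z f) (+-suc k l))
  (trans (cong (_+ f (k + l)) (rsum-split k l f)) (+-assoc (rsum k f) _ _))

rsum-shift : ∀ k f → rsum (suc k) f ≡ f 0 + rsum k (λ j → f (suc j))
rsum-shift k f = rsum-split 1 k f

rsum-const : ∀ k c → rsum k (λ _ → c) ≡ k * c
rsum-const zero    c = refl
rsum-const (suc k) c = trans (cong (_+ c) (rsum-const k c)) (+-comm (k * c) c)

rsum-≤ : ∀ k f → (∀ j → f j ≤ 1) → rsum k f ≤ k
rsum-≤ zero    f h = z≤n
rsum-≤ (suc k) f h = ≤-trans (+-mono-≤ (rsum-≤ k f h) (h k)) (≤-reflexive (+-comm k 1))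

sum-rsum : ∀ m f → sumFin m (λ i → f (toℕ i)) ≡ rsum m f
sum-rsum zero    f = refl
sum-rsum (suc m) f = trans (cong (f 0 +_) (sum-rsum m (λ j → f (suc j)))) (sym (rsum-shift m f))

count : ∀ m → (Fin m → Bool) → ℕ
count m p = sumFin m (λ a → ind (p a))

count-unique : ∀ m (p : Fin m → Bool) → (∀ a c → p a ≡ true → p c ≡ true → a ≡ c) →
  count m p ≤ 1
count-unique zero    p uniq = z≤n
count-unique (suc m) p uniq with p F.zero in p0
... | true  = ≤-reflexive (cong suc (sum-0 m (λ i → ind-false _ (λ pi → 0≢suc (uniq _ _ p0 pi)))))
  where
  0≢suc : ∀ {i : Fin m} → ¬ F.zero ≡ F.suc i
  0≢suc ()
... | false = count-unique m (λ i → p (F.suc i)) (λ a c pa pc → FP.suc-injective (uniq _ _ pa pc))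

<ᵇ-suc : ∀ x k → ind (x <ᵇ suc k) ≡ ind (x <ᵇ k) + ind (x ≡ᵇ k)
<ᵇ-suc zero    zero    = refl
<ᵇ-suc zero    (suc k) = refl
<ᵇ-suc (suc x) zero    = refl
<ᵇ-suc (suc x) (suc k) = <ᵇ-suc x k

-- An injective ranking r of m elements with values below m is a bijection
-- onto {0,…,m-1}; hence exactly k elements have rank below k.
count-ranks-below : ∀ m (r : Fin m → ℕ) → (∀ a c → r a ≡ r c → a ≡ c) → (∀ a → r a < m) →
  ∀ k → k ≤ m → count m (λ a → r a <ᵇ k) ≡ k
count-ranks-below m r injective bounded k k≤m =
  ≤-antisym (≤-trans (≤-reflexive (below k)) (rsum-≤ k mult mult≤1)) (subst (k ≤_) (sym (below k)) atLeast)
  where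
  open ≤-Reasoning
  mult : ℕ → ℕ
  mult j = count m (λ a → r a ≡ᵇ j)
  mult≤1 : ∀ j → mult j ≤ 1
  mult≤1 j = count-unique m (λ a → r a ≡ᵇ j)
    (λ a c p q → injective a c (trans (≡ᵇ-sound _ _ p) (sym (≡ᵇ-sound _ _ q))))
  below : ∀ k → count m (λ a → r a <ᵇ k) ≡ rsum k mult
  below zero    = sum-0 m (λ a → cong ind (<ᵇ-false (r a) 0 z≤n))
  below (suc k) = trans (sum-cong m (λ a → <ᵇ-suc (r a) k)) (trans (sum-+ m _ _) (cong (_+ mult k) (below k)))
  all : rsum m mult ≡ m
  all = trans (sym (below m)) (trans (sum-cong m (λ a → cong ind (<ᵇ-complete (bounded a)))) (sum-1 m))
  l : ℕ
  l = m ∸ k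
  atLeast : k ≤ rsum k mult
  atLeast = +-cancelʳ-≤ l k (rsum k mult) (begin
    k + l                              ≡⟨ m+[n∸m]≡n k≤m ⟩
    m                                  ≡⟨ sym all ⟩
    rsum m mult                        ≡⟨ cong (λ z → rsum z mult) (sym (m+[n∸m]≡n k≤m)) ⟩
    rsum (k + l) mult                  ≡⟨ rsum-split k l mult ⟩
    rsum k mult + rsum l (λ j → mult (k + j))
      ≤⟨ +-monoʳ-≤ (rsum k mult) (rsum-≤ l (λ j → mult (k + j)) (λ j → mult≤1 (k + j))) ⟩
    rsum k mult + l                    ∎)

difference-balanced : ∀ m (x y : Fin m → Bool) → count m x ≡ count m y →
  count m (λ a → x a ∧ not (y a)) ≡ count m (λ a → not (x a) ∧ y a)
difference-balanced m x y eq = +-cancelˡ-≡ (count m (λ a → x a ∧ y a)) _ _ (begin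
  count m (λ a → x a ∧ y a) + count m (λ a → x a ∧ not (y a)) ≡⟨ sym (sum-+ m _ _) ⟩
  sumFin m (λ a → ind (x a ∧ y a) + ind (x a ∧ not (y a)))    ≡⟨ sum-cong m (λ a → sym (ind-split (x a) (y a))) ⟩
  count m x                                                   ≡⟨ eq ⟩
  count m y                                                   ≡⟨ sum-cong m (λ a → splitY (x a) (y a)) ⟩
  sumFin m (λ a → ind (x a ∧ y a) + ind (not (x a) ∧ y a))    ≡⟨ sum-+ m _ _ ⟩
  count m (λ a → x a ∧ y a) + count m (λ a → not (x a) ∧ y a) ∎)
  where
  open ≡-Reasoning
  splitY : ∀ p q → ind q ≡ ind (p ∧ q) + ind (not p ∧ q)
  splitY true  q = sym (+-identityʳ (ind q))
  splitY false q = refl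

-- Let X, Y ⊆ Fin m have equal size, and give every element a
-- direction (down a or not).  Call an element of Y∖X misdirected if it points
-- down, and an element of X∖Y misdirected if it points up.  If misdirected
-- elements never occur in Y∖X and in X∖Y at the same time, then there are at
-- most as many misdirected elements as correctly directed ones in X △ Y.
module Exchange (m : ℕ) (x y down : Fin m → Bool) where
  wrongYX wrongXY rightXY rightYX : ℕ
  wrongYX = count m (λ a → down a ∧ not (x a) ∧ y a)
  wrongXY = count m (λ a → not (down a) ∧ not (y a) ∧ x a)
  rightXY = count m (λ a → down a ∧ x a ∧ not (y a))
  rightYX = count m (λ a → not (down a) ∧ y a ∧ not (x a))

  balance : count m x ≡ count m y → rightXY + wrongXY ≡ wrongYX + rightYX
  balance eq = trans (sym (trans (sum-cong m (λ a → splitXY (down a) (x a) (y a))) (sum-+ m _ _)))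
              (trans (difference-balanced m x y eq)
                     (trans (sum-cong m (λ a → splitYX (down a) (x a) (y a))) (sum-+ m _ _)))
    where
    splitXY : ∀ d p q → ind (p ∧ not q) ≡ ind (d ∧ p ∧ not q) + ind (not d ∧ not q ∧ p)
    splitXY true  p     q     = sym (+-identityʳ _)
    splitXY false true  true  = refl
    splitXY false true  false = refl
    splitXY false false q     = sym (cong ind (∧-zeroʳ (not q)))
    splitYX : ∀ d p q → ind (not p ∧ q) ≡ ind (d ∧ not p ∧ q) + ind (not d ∧ q ∧ not p)
    splitYX true  p     q     = sym (+-identityʳ _)
    splitYX false true  q     = sym (cong ind (∧-zeroʳ q))
    splitYX false false true  = refl
    splitYX false false false = refl

  exchange : count m x ≡ count m y →
    (∀ a a' → (not (down a) ∧ not (y a) ∧ x a) ≡ true → (down a' ∧ not (x a') ∧ y a') ≡ true → ⊥) →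
    wrongYX + wrongXY ≤ rightXY + rightYX
  exchange eq notBoth with wrongXY ≟ 0
  ... | yes none = begin
    wrongYX + wrongXY ≡⟨ cong (wrongYX +_) none ⟩
    wrongYX + 0       ≤⟨ +-monoʳ-≤ wrongYX z≤n ⟩
    wrongYX + rightYX ≡⟨ sym (balance eq) ⟩
    rightXY + wrongXY ≡⟨ cong (rightXY +_) none ⟩
    rightXY + 0       ≤⟨ +-monoʳ-≤ rightXY z≤n ⟩
    rightXY + rightYX ∎
    where open ≤-Reasoning
  ... | no some with sum-nonzero m _ some
  ... | a , wrongAtA = begin
    wrongYX + wrongXY ≡⟨ cong (_+ wrongXY) noneYX ⟩
    0 + wrongXY       ≤⟨ +-monoˡ-≤ wrongXY z≤n ⟩
    rightXY + wrongXY ≡⟨ balance eq ⟩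
    wrongYX + rightYX ≡⟨ cong (_+ rightYX) noneYX ⟩
    0 + rightYX       ≤⟨ +-monoˡ-≤ rightYX z≤n ⟩
    rightXY + rightYX ∎
    where
    open ≤-Reasoning
    noneYX : wrongYX ≡ 0
    noneYX = sum-0 m (λ a' → ind-false _ (notBoth a a' (ind-true _ wrongAtA)))

arc-irrefl : ∀ {G} (o : Orientation G) v → arc o v v ≡ false
arc-irrefl {G} o v with arc o v v in loop
... | true  = ⊥-elim (true≢false (arc-edge o v v loop) (irrefl G v))
... | false = refl

acyclic-transitive : ∀ {G} (o : Orientation G) → Acyclic o → ∀ u v w →
  arc o u v ≡ true → arc o v w ≡ true → adj G u w ≡ true → arc o u w ≡ true
acyclic-transitive o acyclic u v w uv vw uw with arc-tot o u w uw
... | inj₁ arc-uw = arc-uw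
... | inj₂ arc-wu = ⊥-elim (acyclic u (cons uv (cons vw (step arc-wu))))

leaving entering : ∀ {G} → Orientation G → (Fin (N G) → Bool) → ℕ
leaving  {G} o S = sumFin (N G) (λ u → sumFin (N G) (λ v → ind (arc o u v ∧ S u ∧ not (S v))))
entering {G} o S = sumFin (N G) (λ u → sumFin (N G) (λ v → ind (arc o u v ∧ not (S u) ∧ S v)))

-- Cut bound: the cost is at least the net number of arcs leaving any vertex
-- set S, because Σ_{v ∈ S} (d⁺ v − d⁻ v) counts arcs inside S once positively
-- and once negatively.
cost-≥-cut : ∀ {G} (o : Orientation G) (S : Fin (N G) → Bool) → leaving o S ∸ entering o S ≤ cost o
cost-≥-cut {G} o S = begin
  leaving o S ∸ entering o S                          ≡⟨ sym ([m+n]∸[m+o]≡n∸o inside _ _) ⟩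
  (inside + leaving o S) ∸ (inside + entering o S)   ≡⟨ sym (cong₂ _∸_ outOfS intoS) ⟩
  Σᵥ (λ v → ind (S v) * outdeg o v) ∸ Σᵥ (λ v → ind (S v) * indeg o v)
    ≤⟨ sum-∸ n _ _ ⟩
  Σᵥ (λ v → ind (S v) * outdeg o v ∸ ind (S v) * indeg o v)
    ≤⟨ sum-mono n (λ v → restrict (S v) (outdeg o v) (indeg o v)) ⟩
  cost o                                              ∎
  where
  open ≤-Reasoning
  n : ℕ
  n = N G
  Σᵥ : (Fin n → ℕ) → ℕ
  Σᵥ = sumFin n
  inside : ℕ
  inside = Σᵥ (λ u → Σᵥ (λ v → ind (arc o u v ∧ S u ∧ S v)))
  restrict : ∀ s a b → ind s * a ∸ ind s * b ≤ a ∸ b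
  restrict true  a b rewrite *-identityˡ a | *-identityˡ b = ≤-refl
  restrict false a b = z≤n
  splitOut : ∀ s a t → ind s * ind a ≡ ind (a ∧ s ∧ t) + ind (a ∧ s ∧ not t)
  splitOut true  true  true  = refl
  splitOut true  true  false = refl
  splitOut true  false t     = refl
  splitOut false a     t     = sym (cong₂ (λ p q → ind p + ind q) (∧-zeroʳ a) (∧-zeroʳ a))
  splitIn : ∀ s a t → ind t * ind a ≡ ind (a ∧ s ∧ t) + ind (a ∧ not s ∧ t)
  splitIn true  true  true  = refl
  splitIn false true  true  = refl
  splitIn s     false t     = *-zeroʳ (ind t)
  splitIn true  true  false = refl
  splitIn false true  false = refl
  outOfS : Σᵥ (λ u → ind (S u) * outdeg o u) ≡ inside + leaving o S
  outOfS = trans (sum-cong n (λ u → trans (sym (sum-*ˡ n (ind (S u)) _))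
                                          (trans (sum-cong n (λ v → splitOut (S u) (arc o u v) (S v))) (sum-+ n _ _))))
                 (sum-+ n _ _)
  intoS : Σᵥ (λ v → ind (S v) * indeg o v) ≡ inside + entering o S
  intoS = trans (sum-cong n (λ v → sym (sum-*ˡ n (ind (S v)) _)))
         (trans (sum-swap n n _)
         (trans (sum-cong n (λ u → trans (sum-cong n (λ v → splitIn (S u) (arc o u v) (S v))) (sum-+ n _ _)))
                (sum-+ n _ _)))

-- An acyclic orientation restricted to a clique f : Fin m → V(G) is a
-- transitive tournament.  Ranking the clique's vertices by their in-degree
-- inside the clique identifies them with 0, …, m-1, and the h vertices of
-- lowest rank (the "top" h) send arcs to all the others.
module CliqueRanking {G : Graph} (o : Orientation G) (acyclic : Acyclic o)
                     {m : ℕ} (f : Fin m → Fin (N G))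
                     (clique : ∀ a c → ¬ a ≡ c → adj G (f a) (f c) ≡ true) where

  rank : Fin m → ℕ
  rank a = sumFin m (λ e → ind (arc o (f e) (f a)))

  -- Every in-neighbour of c inside the clique is one of a as well (by
  -- transitivity), and c itself is an in-neighbour of a but not of c.
  rank-< : ∀ c a → arc o (f c) (f a) ≡ true → rank c < rank a
  rank-< c a c→a = sum-strict m _ _ c pointwise atC
    where
    pointwise : ∀ e → ind (arc o (f e) (f c)) ≤ ind (arc o (f e) (f a))
    pointwise e = ind-mono _ _ (λ e→c → acyclic-transitive o acyclic _ _ _ e→c c→a (clique e a (e≢a e→c)))
      where
      e≢a : arc o (f e) (f c) ≡ true → ¬ e ≡ a
      e≢a e→c refl = true≢false c→a (arc-anti o _ _ e→c)
    atC : ind (arc o (f c) (f c)) < ind (arc o (f c) (f a))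
    atC rewrite arc-irrefl o (f c) | c→a = s≤s z≤n

  rank-injective : ∀ a c → rank a ≡ rank c → a ≡ c
  rank-injective a c eq with a FP.≟ c
  ... | yes a≡c = a≡c
  ... | no  a≢c with arc-tot o _ _ (clique a c a≢c)
  ... | inj₁ a→c = ⊥-elim (<-irrefl eq (rank-< a c a→c))
  ... | inj₂ c→a = ⊥-elim (<-irrefl (sym eq) (rank-< c a c→a))

  rank-bounded : ∀ a → rank a < m
  rank-bounded a = subst (rank a <_) (sum-1 m)
    (sum-strict m _ (λ _ → 1) a (λ e → ind≤1 _) (subst (λ z → ind z < 1) (sym (arc-irrefl o (f a))) (s≤s z≤n)))

  top : ℕ → Fin m → Bool
  top h a = rank a <ᵇ h

  count-top : ∀ h → h ≤ m → count m (top h) ≡ h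
  count-top h h≤m = count-ranks-below m rank rank-injective rank-bounded h h≤m

  count-bottom : ∀ h → h ≤ m → count m (λ a → not (top h a)) ≡ m ∸ h
  count-bottom h h≤m = begin
    bottom           ≡⟨ sym (m+n∸m≡n h bottom) ⟩
    (h + bottom) ∸ h ≡⟨ cong (_∸ h) partition ⟩
    m ∸ h            ∎
    where
    open ≡-Reasoning
    bottom : ℕ
    bottom = count m (λ a → not (top h a))
    partition : h + bottom ≡ m
    partition = begin
      h + bottom                                           ≡⟨ cong (_+ bottom) (sym (count-top h h≤m)) ⟩
      count m (top h) + bottom                             ≡⟨ sym (sum-+ m _ _) ⟩
      sumFin m (λ a → ind (top h a) + ind (not (top h a))) ≡⟨ sum-cong m (λ a → ind-not (top h a)) ⟩
      sumFin m (λ _ → 1)                                   ≡⟨ sum-1 m ⟩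
      m                                                    ∎

  top-beats-bottom : ∀ h a c → top h a ≡ true → top h c ≡ false → arc o (f a) (f c) ≡ true
  top-beats-bottom h a c topA bottomC with a FP.≟ c
  ... | yes refl = ⊥-elim (true≢false topA bottomC)
  ... | no  a≢c with arc-tot o _ _ (clique a c a≢c)
  ... | inj₁ a→c = a→c
  ... | inj₂ c→a = ⊥-elim (<-irrefl refl
          (<-≤-trans (<-trans (rank-< c a c→a) (<ᵇ-sound (rank a) h topA)) (<ᵇ-false-sound (rank c) h bottomC)))

indexOrientation : (G : Graph) → Orientation G
indexOrientation G = record
  { arc      = λ u v → adj G u v ∧ (toℕ u <ᵇ toℕ v)
  ; arc-edge = λ u v r → proj₁ (∧-true _ _ r)
  ; arc-tot  = total
  ; arc-anti = anti
  }
  where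
  total : ∀ u v → adj G u v ≡ true →
    (adj G u v ∧ (toℕ u <ᵇ toℕ v)) ≡ true ⊎ (adj G v u ∧ (toℕ v <ᵇ toℕ u)) ≡ true
  total u v uv with <-cmp (toℕ u) (toℕ v)
  ... | tri< u<v _ _ rewrite uv | <ᵇ-complete u<v = inj₁ refl
  ... | tri≈ _ u≡v _ rewrite FP.toℕ-injective u≡v = ⊥-elim (true≢false uv (irrefl G v))
  ... | tri> _ _ v<u rewrite trans (adj-sym G v u) uv | <ᵇ-complete v<u = inj₂ refl
  anti : ∀ u v → (adj G u v ∧ (toℕ u <ᵇ toℕ v)) ≡ true → (adj G v u ∧ (toℕ v <ᵇ toℕ u)) ≡ false
  anti u v r rewrite <ᵇ-false (toℕ v) (toℕ u) (<⇒≤ (<ᵇ-sound _ _ (proj₂ (∧-true (adj G u v) _ r)))) =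
    ∧-zeroʳ _

indexOrientation-acyclic : (G : Graph) → Acyclic (indexOrientation G)
indexOrientation-acyclic G v cycle = <-irrefl refl (increasing cycle)
  where
  increasing : ∀ {u w} → DWalk (indexOrientation G) u w → toℕ u < toℕ w
  increasing (step r)   = <ᵇ-sound _ _ (proj₂ (∧-true _ _ r))
  increasing (cons r p) = <-trans (<ᵇ-sound _ _ (proj₂ (∧-true _ _ r))) (increasing p)

-- The graph K m □ P n in coordinates: vertex a b is the copy of a ∈ K m in
-- layer b ∈ P n.
module Product (m n : ℕ) where

  KP : Graph
  KP = K m □ P n

  vertex : Fin m → Fin n → Fin (m * n)
  vertex = combine

  adj-vertex : ∀ a b c d →
    adj KP (vertex a b) (vertex c d) ≡ (((a == c) ∧ pathAdj b d) ∨ (not (a == c) ∧ (b == d)))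
  adj-vertex a b c d =
    cong₂ (pairAdj (K m) (P n)) (FP.remQuot-combine {m} {n} a b) (FP.remQuot-combine {m} {n} c d)

  layer-adj : ∀ a c b → ¬ a ≡ c → adj KP (vertex a b) (vertex c b) ≡ true
  layer-adj a c b a≢c rewrite adj-vertex a b c b | ==-false a c a≢c | ==-refl b = refl

  column-adj : ∀ a b d → adj KP (vertex a b) (vertex a d) ≡ pathAdj b d
  column-adj a b d rewrite adj-vertex a b a d | ==-refl a with pathAdj b d
  ... | true  = refl
  ... | false = refl

  non-adj : ∀ a b c d → ¬ a ≡ c → ¬ b ≡ d → adj KP (vertex a b) (vertex c d) ≡ false
  non-adj a b c d a≢c b≢d rewrite adj-vertex a b c d | ==-false a c a≢c | ==-false b d b≢d = refl

  Σ4 : (Fin m → Fin n → Fin m → Fin n → ℕ) → ℕ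
  Σ4 F = sumFin m (λ a → sumFin n (λ b → sumFin m (λ c → sumFin n (λ d → F a b c d))))

  sum-vertex-pairs : ∀ (F : Fin (m * n) → Fin (m * n) → ℕ) →
    sumFin (m * n) (λ u → sumFin (m * n) (F u)) ≡ Σ4 (λ a b c d → F (vertex a b) (vertex c d))
  sum-vertex-pairs F = trans (sum-combine m n _)
    (sum-cong m (λ a → sum-cong n (λ b → sum-combine m n (F (vertex a b)))))

  Σ4-cong : ∀ {F F'} → (∀ a b c d → F a b c d ≡ F' a b c d) → Σ4 F ≡ Σ4 F'
  Σ4-cong e = sum-cong m (λ a → sum-cong n (λ b → sum-cong m (λ c → sum-cong n (e a b c))))

  Σ4-+ : ∀ {F F'} → Σ4 (λ a b c d → F a b c d + F' a b c d) ≡ Σ4 F + Σ4 F'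
  Σ4-+ = trans (sum-cong m (λ a → trans (sum-cong n (λ b →
           trans (sum-cong m (λ c → sum-+ n _ _)) (sum-+ m _ _))) (sum-+ n _ _))) (sum-+ m _ _)

  horizontal vertical : (Fin m → Fin n → Fin m → Fin n → Bool) → ℕ
  horizontal R = sumFin n (λ b → sumFin m (λ a → sumFin m (λ c → ind (R a b c b))))
  vertical   R = sumFin n (λ b → sumFin n (λ d → sumFin m (λ a → ind (R a b a d))))

  OnEdges : (Fin m → Fin n → Fin m → Fin n → Bool) → Set
  OnEdges R = ∀ a b c d → R a b c d ≡ true → adj KP (vertex a b) (vertex c d) ≡ true

  same-layer-part : (R : Fin m → Fin n → Fin m → Fin n → Bool) →
    Σ4 (λ a b c d → ind (R a b c d ∧ (b == d))) ≡ horizontal R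
  same-layer-part R = trans (sum-cong m (λ a → sum-cong n (λ b → sum-cong m (λ c → onLayer a b c)))) (sum-swap m n _)
    where
    onLayer : ∀ a b c → sumFin n (λ d → ind (R a b c d ∧ (b == d))) ≡ ind (R a b c b)
    onLayer a b c = trans (sum-single n _ b offLayer)
      (trans (cong (λ z → ind (R a b c b ∧ z)) (==-refl b)) (cong ind (∧-identityʳ (R a b c b))))
      where
      offLayer : ∀ d → ¬ d ≡ b → ind (R a b c d ∧ (b == d)) ≡ 0
      offLayer d d≢b rewrite ==-false b d (λ e → d≢b (sym e)) = cong ind (∧-zeroʳ (R a b c d))

  -- The pairs in different layers: along edges these lie in a common column,
  -- and a vertex is never related to itself.
  same-column-part : (R : Fin m → Fin n → Fin m → Fin n → Bool) → OnEdges R →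
    Σ4 (λ a b c d → ind (R a b c d ∧ not (b == d))) ≡ vertical R
  same-column-part R R⊆adj = trans
    (sum-cong m (λ a → sum-cong n (λ b → trans (sum-swap m n _) (sum-cong n (λ d →
       trans (sum-single m _ a (λ c c≢a → offColumn a b c d c≢a)) (onColumn a b d))))))
    (trans (sum-swap m n _) (sum-cong n (λ b → sum-swap m n _)))
    where
    offColumn : ∀ a b c d → ¬ c ≡ a → ind (R a b c d ∧ not (b == d)) ≡ 0
    offColumn a b c d c≢a with b FP.≟ d
    ... | yes refl = cong ind (∧-zeroʳ (R a b c b))
    ... | no  b≢d  = ind-false _ (λ r → true≢false (R⊆adj a b c d (proj₁ (∧-true _ _ r)))
                                                  (non-adj a b c d (λ e → c≢a (sym e)) b≢d))
    onColumn : ∀ a b d → ind (R a b a d ∧ not (b == d)) ≡ ind (R a b a d)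
    onColumn a b d with b FP.≟ d
    ... | yes refl = trans (cong ind (∧-zeroʳ (R a b a b)))
                           (sym (ind-false _ (λ r → true≢false (R⊆adj a b a b r) (irrefl KP (vertex a b)))))
    ... | no  b≢d  = cong ind (∧-identityʳ (R a b a d))

  edge-split : (R : Fin m → Fin n → Fin m → Fin n → Bool) → OnEdges R →
    Σ4 (λ a b c d → ind (R a b c d)) ≡ horizontal R + vertical R
  edge-split R R⊆adj = begin
    Σ4 (λ a b c d → ind (R a b c d))
      ≡⟨ Σ4-cong (λ a b c d → ind-split (R a b c d) (b == d)) ⟩
    Σ4 (λ a b c d → ind (R a b c d ∧ (b == d)) + ind (R a b c d ∧ not (b == d)))
      ≡⟨ Σ4-+ ⟩
    Σ4 (λ a b c d → ind (R a b c d ∧ (b == d))) + Σ4 (λ a b c d → ind (R a b c d ∧ not (b == d)))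
      ≡⟨ cong₂ _+_ (same-layer-part R) (same-column-part R R⊆adj) ⟩
    horizontal R + vertical R ∎
    where open ≡-Reasoning

  neighbour-sum : ∀ a b (L : Fin (m * n) → Bool) →
    sumFin (m * n) (λ w → ind (adj KP (vertex a b) w ∧ L w))
      ≡ sumFin n (λ d → ind (pathAdj b d ∧ L (vertex a d))) + sumFin m (λ c → ind (not (a == c) ∧ L (vertex c b)))
  neighbour-sum a b L = begin
    sumFin (m * n) (λ w → ind (adj KP (vertex a b) w ∧ L w))
      ≡⟨ sum-combine m n _ ⟩
    sumFin m (λ c → sumFin n (λ d → ind (adj KP (vertex a b) (vertex c d) ∧ L (vertex c d))))
      ≡⟨ sum-cong m (λ c → trans (sum-cong n (λ d → trans (cong (λ e → ind (e ∧ L (vertex c d))) (adj-vertex a b c d))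
                                                          (split (a == c) (pathAdj b d) (b == d) (L (vertex c d)))))
                                 (sum-+ n _ _)) ⟩
    sumFin m (λ c → column c + layer c)
      ≡⟨ sum-+ m column layer ⟩
    sumFin m column + sumFin m layer
      ≡⟨ cong₂ _+_ onColumn (sum-cong m onLayer) ⟩
    sumFin n (λ d → ind (pathAdj b d ∧ L (vertex a d))) + sumFin m (λ c → ind (not (a == c) ∧ L (vertex c b))) ∎
    where
    open ≡-Reasoning
    split : ∀ e p q l → ind (((e ∧ p) ∨ (not e ∧ q)) ∧ l) ≡ ind (e ∧ p ∧ l) + ind (not e ∧ q ∧ l)
    split true  true  q l = sym (+-identityʳ _)
    split true  false q l = refl
    split false p     q l = refl
    column layer : Fin m → ℕ
    column c = sumFin n (λ d → ind ((a == c) ∧ pathAdj b d ∧ L (vertex c d)))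
    layer  c = sumFin n (λ d → ind (not (a == c) ∧ (b == d) ∧ L (vertex c d)))
    onColumn : sumFin m column ≡ sumFin n (λ d → ind (pathAdj b d ∧ L (vertex a d)))
    onColumn = trans (sum-single m column a (λ c c≢a → sum-0 n (λ d →
                        cong (λ e → ind (e ∧ pathAdj b d ∧ L (vertex c d))) (==-false a c (λ e → c≢a (sym e))))))
                     (sum-cong n (λ d → cong (λ e → ind (e ∧ pathAdj b d ∧ L (vertex a d))) (==-refl a)))
    onLayer : ∀ c → layer c ≡ ind (not (a == c) ∧ L (vertex c b))
    onLayer c = trans (sum-single n _ b (λ d d≢b → trans
                         (cong (λ e → ind (not (a == c) ∧ e ∧ L (vertex c d))) (==-false b d (λ e → d≢b (sym e))))
                         (cong ind (∧-zeroʳ (not (a == c))))))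
                      (cong (λ e → ind (not (a == c) ∧ e ∧ L (vertex c b))) (==-refl b))

  -- Comparing vertex indices: toℕ (vertex a b) = n · toℕ a + toℕ b.
  column-order : ∀ a b d → (toℕ (vertex a b) <ᵇ toℕ (vertex a d)) ≡ (toℕ b <ᵇ toℕ d)
  column-order a b d =
    trans (cong₂ _<ᵇ_ (FP.toℕ-combine a b) (FP.toℕ-combine a d)) (<ᵇ-+ˡ (n * toℕ a) (toℕ b) (toℕ d))

  layer-order : ∀ a c b → (toℕ (vertex a b) <ᵇ toℕ (vertex c b)) ≡ (toℕ a <ᵇ toℕ c)
  layer-order a c b = trans (cong₂ _<ᵇ_ (FP.toℕ-combine a b) (FP.toℕ-combine c b)) scaled
    where
    instance
      n≢0 : NonZero n
      n≢0 = >-nonZero (≤-<-trans z≤n (FP.toℕ<n b))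
    scaled : (n * toℕ a + toℕ b <ᵇ n * toℕ c + toℕ b) ≡ (toℕ a <ᵇ toℕ c)
    scaled with toℕ a <ᵇ toℕ c in a<c
    ... | true  = <ᵇ-complete (+-monoˡ-< (toℕ b) (*-monoʳ-< n (<ᵇ-sound _ _ a<c)))
    ... | false = <ᵇ-false _ _ (+-monoˡ-≤ (toℕ b) (*-monoʳ-≤ n (<ᵇ-false-sound _ _ a<c)))

-- In every
-- layer b, let Top b be the h vertices of lowest rank in the tournament of
-- that layer, and let S be the union of all Top b.  Then
--   • in each layer all h·h edges between Top b and its complement leave S,
--     and no layer arc enters S;
--   • on the column edges between two adjacent layers, the exchange lemma
--     shows that at least as many arcs leave S as enter it: a misdirected
--     pair would close a directed 4-cycle.
-- So at least n·h² more arcs leave S than enter it, and the cut bound applies.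
module LowerBound (h n : ℕ) (o : Orientation (K (h + h) □ P n)) (acyclic : Acyclic o) where
  private
    m : ℕ
    m = h + h
  open Product m n

  arcV : Fin m → Fin n → Fin m → Fin n → Bool
  arcV a b c d = arc o (vertex a b) (vertex c d)

  module Layer (b : Fin n) =
    CliqueRanking o acyclic (λ a → vertex a b) (λ a c a≢c → layer-adj a c b a≢c)

  inTop : Fin m → Fin n → Bool
  inTop a b = Layer.top b h a

  h≤m : h ≤ m
  h≤m = m≤m+n h h

  top-size : ∀ b → count m (λ a → inTop a b) ≡ h
  top-size b = Layer.count-top b h h≤m

  bottom-size : ∀ b → count m (λ a → not (inTop a b)) ≡ h
  bottom-size b = trans (Layer.count-bottom b h h≤m) (m+n∸m≡n h h)

  top-beats-bottom : ∀ a c b → inTop a b ≡ true → inTop c b ≡ false → arcV a b c b ≡ true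
  top-beats-bottom a c b = Layer.top-beats-bottom b h a c

  outArc inArc : Fin m → Fin n → Fin m → Fin n → Bool
  outArc a b c d = arcV a b c d ∧ inTop a b ∧ not (inTop c d)
  inArc  a b c d = arcV a b c d ∧ not (inTop a b) ∧ inTop c d

  S : Fin (m * n) → Bool
  S v = inTop (proj₁ (remQuot {m} n v)) (proj₂ (remQuot {m} n v))

  S-vertex : ∀ a b → S (vertex a b) ≡ inTop a b
  S-vertex a b = cong (λ p → inTop (proj₁ p) (proj₂ p)) (FP.remQuot-combine {m} {n} a b)

  arcs-by-membership : (sel : Bool → Bool → Bool) →
    sumFin (m * n) (λ u → sumFin (m * n) (λ v → ind (arc o u v ∧ sel (S u) (S v))))
      ≡ Σ4 (λ a b c d → ind (arcV a b c d ∧ sel (inTop a b) (inTop c d)))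
  arcs-by-membership sel = trans (sum-vertex-pairs _) (Σ4-cong (λ a b c d →
    cong₂ (λ p q → ind (arcV a b c d ∧ sel p q)) (S-vertex a b) (S-vertex c d)))

  arcs-on-edges : (sel : Bool → Bool → Bool) → OnEdges (λ a b c d → arcV a b c d ∧ sel (inTop a b) (inTop c d))
  arcs-on-edges sel a b c d r = arc-edge o _ _ (proj₁ (∧-true _ _ r))

  leaving-S : leaving o S ≡ horizontal outArc + vertical outArc
  leaving-S = trans (arcs-by-membership (λ p q → p ∧ not q)) (edge-split outArc (arcs-on-edges (λ p q → p ∧ not q)))

  entering-S : entering o S ≡ horizontal inArc + vertical inArc
  entering-S = trans (arcs-by-membership (λ p q → not p ∧ q)) (edge-split inArc (arcs-on-edges (λ p q → not p ∧ q)))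

  -- Inside a layer, an edge leaves S exactly when it joins Top b to its complement.
  horizontal-out : horizontal outArc ≡ n * (h * h)
  horizontal-out = trans (sum-cong n (λ b → trans (sum-cong m (λ a → perTop a b)) (layerCount b))) (sum-const n (h * h))
    where
    product : ∀ a c b → ind (outArc a b c b) ≡ ind (inTop a b) * ind (not (inTop c b))
    product a c b with inTop a b in topA | inTop c b in topC
    ... | true  | false rewrite top-beats-bottom a c b topA topC = refl
    ... | true  | true  = cong ind (∧-zeroʳ (arcV a b c b))
    ... | false | _     = cong ind (∧-zeroʳ (arcV a b c b))
    perTop : ∀ a b → sumFin m (λ c → ind (outArc a b c b)) ≡ ind (inTop a b) * h
    perTop a b = trans (sum-cong m (λ c → product a c b))
                       (trans (sum-*ˡ m (ind (inTop a b)) _) (cong (ind (inTop a b) *_) (bottom-size b)))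
    layerCount : ∀ b → sumFin m (λ a → ind (inTop a b) * h) ≡ h * h
    layerCount b = trans (sum-cong m (λ a → *-comm (ind (inTop a b)) h))
                         (trans (sum-*ˡ m h _) (cong (h *_) (top-size b)))

  horizontal-in : horizontal inArc ≡ 0
  horizontal-in = sum-0 n (λ b → sum-0 m (λ a → sum-0 m (λ c → ind-false _ (λ r → noEntry a b c r))))
    where
    noEntry : ∀ a b c → inArc a b c b ≡ true → ⊥
    noEntry a b c r with ∧-true (arcV a b c b) _ r
    ... | a→c , tops with ∧-true (not (inTop a b)) _ tops
    ... | bottomA , topC = true≢false a→c (arc-anti o _ _ (top-beats-bottom c a b topC (not-true _ bottomA)))

  columnIn columnOut : Fin n → Fin n → ℕ
  columnIn  b d = sumFin m (λ a → ind (inArc a b a d))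
  columnOut b d = sumFin m (λ a → ind (outArc a b a d))

  columnIn-nonadjacent : ∀ b d → pathAdj b d ≡ false → columnIn b d ≡ 0
  columnIn-nonadjacent b d b≁d = sum-0 m (λ a → ind-false _ (λ r →
    true≢false (trans (sym (column-adj a b d)) (arc-edge o _ _ (proj₁ (∧-true _ _ r)))) b≁d))

  -- Between adjacent layers b, d apply the exchange lemma with X = Top b,
  -- Y = Top d and down a = the arc (a,b) → (a,d).  If a ∈ X∖Y points up and
  -- a' ∈ Y∖X points down, then (a,b) → (a',b) → (a',d) → (a,d) → (a,b) is a
  -- directed cycle.
  column-pair : ∀ b d → columnIn b d + columnIn d b ≤ columnOut b d + columnOut d b
  column-pair b d with pathAdj b d in b~d
  ... | false = subst (_≤ columnOut b d + columnOut d b)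
                      (sym (cong₂ _+_ (columnIn-nonadjacent b d b~d)
                                      (columnIn-nonadjacent d b (trans (adj-sym (P n) d b) b~d))))
                      z≤n
  ... | true  = subst₂ _≤_ (cong (columnIn b d +_) (sym inFromD)) (cong (columnOut b d +_) (sym outFromD))
                           (exchange (trans (top-size b) (sym (top-size d))) noBoth)
    where
    x y down : Fin m → Bool
    x a    = inTop a b
    y a    = inTop a d
    down a = arcV a b a d
    open Exchange m x y down
    reverse : ∀ a → arcV a d a b ≡ not (down a)
    reverse a with arc-tot o _ _ (trans (column-adj a b d) b~d)
    ... | inj₁ b→d rewrite b→d = arc-anti o _ _ b→d
    ... | inj₂ d→b rewrite d→b | arc-anti o _ _ d→b = refl
    inFromD : columnIn d b ≡ wrongXY
    inFromD = sum-cong m (λ a → cong (λ w → ind (w ∧ not (y a) ∧ x a)) (reverse a))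
    outFromD : columnOut d b ≡ rightYX
    outFromD = sum-cong m (λ a → cong (λ w → ind (w ∧ y a ∧ not (x a))) (reverse a))
    noBoth : ∀ a a' → (not (down a) ∧ not (y a) ∧ x a) ≡ true → (down a' ∧ not (x a') ∧ y a') ≡ true → ⊥
    noBoth a a' r r' with ∧-true (not (down a)) _ r | ∧-true (down a') _ r'
    ... | upA , rest | downA' , rest' with ∧-true (not (y a)) _ rest | ∧-true (not (x a')) _ rest'
    ... | bottomDA , topBA | bottomBA' , topDA' =
      acyclic (vertex a b)
        (cons (top-beats-bottom a a' b topBA (not-true _ bottomBA'))
        (cons downA'
        (cons (top-beats-bottom a' a d topDA' (not-true _ bottomDA))
        (step (trans (reverse a) (cong not (not-true _ upA)))))))

  lower-bound : n * (h * h) ≤ cost o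
  lower-bound = begin
    n * (h * h)                                   ≤⟨ m+n≤o⇒m≤o∸n (n * (h * h)) netLeaving ⟩
    leaving o S ∸ entering o S                    ≤⟨ cost-≥-cut o S ⟩
    cost o                                        ∎
    where
    open ≤-Reasoning
    verticalIn≤Out : vertical inArc ≤ vertical outArc
    verticalIn≤Out = sum-symmetric-≤ n columnIn columnOut column-pair
    netLeaving : n * (h * h) + entering o S ≤ leaving o S
    netLeaving = begin
      n * (h * h) + entering o S
        ≡⟨ cong (n * (h * h) +_) (trans entering-S (cong (_+ vertical inArc) horizontal-in)) ⟩
      n * (h * h) + vertical inArc
        ≤⟨ +-monoʳ-≤ (n * (h * h)) verticalIn≤Out ⟩
      n * (h * h) + vertical outArc
        ≡⟨ sym (trans leaving-S (cong (_+ vertical outArc) horizontal-out)) ⟩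
      leaving o S ∎

count-equal : ∀ n k → sumFin n (λ d → ind (k ≡ᵇ toℕ d)) ≡ ind (k <ᵇ n)
count-equal zero    k       = refl
count-equal (suc n) zero    = cong suc (sum-0 n (λ _ → refl))
count-equal (suc n) (suc k) = count-equal n k

count-successor : ∀ n k → k ≤ n → sumFin n (λ d → ind (suc (toℕ d) ≡ᵇ k)) ≡ ind (0 <ᵇ k)
count-successor zero    zero    _         = refl
count-successor (suc n) zero    _         = sum-0 (suc n) (λ _ → refl)
count-successor (suc n) (suc k) (s≤s k≤n) = trans (cong (ind (0 ≡ᵇ k) +_) (count-successor n k k≤n)) (zeroOrPositive k)
  where
  zeroOrPositive : ∀ k → ind (0 ≡ᵇ k) + ind (0 <ᵇ k) ≡ 1
  zeroOrPositive zero    = refl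
  zeroOrPositive (suc k) = refl

count-above : ∀ m k → sumFin m (λ c → ind (k <ᵇ toℕ c)) ≡ m ∸ suc k
count-above zero    k       = refl
count-above (suc m) zero    = sum-1 m
count-above (suc m) (suc k) = count-above m k

count-below : ∀ m k → k ≤ m → sumFin m (λ c → ind (toℕ c <ᵇ k)) ≡ k
count-below m = count-ranks-below m toℕ (λ _ _ → FP.toℕ-injective) FP.toℕ<n

pathAdj-ℕ : ∀ {n} (i j : Fin n) → pathAdj i j ≡ ((suc (toℕ i) ≡ᵇ toℕ j) ∨ (suc (toℕ j) ≡ᵇ toℕ i))
pathAdj-ℕ i j = cong₂ _∨_ (isYes≗does (suc (toℕ i) ≟ toℕ j)) (isYes≗does (suc (toℕ j) ≟ toℕ i))

path-up : ∀ {n} (b : Fin n) → sumFin n (λ d → ind (pathAdj b d ∧ (toℕ b <ᵇ toℕ d))) ≡ ind (suc (toℕ b) <ᵇ n)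
path-up {n} b =
  trans (sum-cong n (λ d → trans (cong (λ e → ind (e ∧ (toℕ b <ᵇ toℕ d))) (pathAdj-ℕ b d)) (above (toℕ b) (toℕ d))))
        (count-equal n (suc (toℕ b)))
  where
  above : ∀ y z → ind (((suc y ≡ᵇ z) ∨ (suc z ≡ᵇ y)) ∧ (y <ᵇ z)) ≡ ind (suc y ≡ᵇ z)
  above zero          zero          = refl
  above zero          (suc zero)    = refl
  above zero          (suc (suc z)) = refl
  above (suc zero)    zero          = refl
  above (suc (suc y)) zero          = refl
  above (suc y)       (suc z)       = above y z

path-down : ∀ {n} (b : Fin n) → sumFin n (λ d → ind (pathAdj b d ∧ (toℕ d <ᵇ toℕ b))) ≡ ind (0 <ᵇ toℕ b)
path-down {n} b =
  trans (sum-cong n (λ d → trans (cong (λ e → ind (e ∧ (toℕ d <ᵇ toℕ b))) (pathAdj-ℕ b d)) (below (toℕ b) (toℕ d))))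
        (count-successor n (toℕ b) (<⇒≤ (FP.toℕ<n b)))
  where
  below : ∀ y z → ind (((suc y ≡ᵇ z) ∨ (suc z ≡ᵇ y)) ∧ (z <ᵇ y)) ≡ ind (suc z ≡ᵇ y)
  below zero          zero          = refl
  below zero          (suc zero)    = refl
  below zero          (suc (suc z)) = refl
  below (suc zero)    zero          = refl
  below (suc (suc y)) zero          = refl
  below (suc y)       (suc z)       = below y z

-- Vertex a b, with
-- x = toℕ a and y = toℕ b, has the column out-neighbour in layer y+1 (if
-- y+1 < n), the column in-neighbour in layer y-1 (if y > 0), the m-1-x layer
-- vertices of larger index as out-neighbours and the x of smaller index as
-- in-neighbours.
module IndexDegrees (m n : ℕ) where
  open Product m n

  ordered : Orientation KP
  ordered = indexOrientation KP

  drop-distinct : ∀ (a c : Fin m) p → (p ≡ true → ¬ a ≡ c) → ind (not (a == c) ∧ p) ≡ ind p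
  drop-distinct a c true  a≢c rewrite ==-false a c (a≢c refl) = refl
  drop-distinct a c false _   = cong ind (∧-zeroʳ (not (a == c)))

  order-distinct : ∀ (a c : Fin m) → (toℕ a <ᵇ toℕ c) ≡ true → ¬ a ≡ c
  order-distinct a c a<c refl = true≢false a<c (<ᵇ-false (toℕ a) (toℕ a) ≤-refl)

  outdeg-vertex : ∀ a b → outdeg ordered (vertex a b) ≡ ind (suc (toℕ b) <ᵇ n) + (m ∸ suc (toℕ a))
  outdeg-vertex a b = trans (neighbour-sum a b (λ w → toℕ (vertex a b) <ᵇ toℕ w)) (cong₂ _+_ columnPart layerPart)
    where
    columnPart : sumFin n (λ d → ind (pathAdj b d ∧ (toℕ (vertex a b) <ᵇ toℕ (vertex a d)))) ≡ ind (suc (toℕ b) <ᵇ n)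
    columnPart = trans (sum-cong n (λ d → cong (λ e → ind (pathAdj b d ∧ e)) (column-order a b d))) (path-up b)
    layerPart : sumFin m (λ c → ind (not (a == c) ∧ (toℕ (vertex a b) <ᵇ toℕ (vertex c b)))) ≡ m ∸ suc (toℕ a)
    layerPart = trans (sum-cong m (λ c → trans (cong (λ e → ind (not (a == c) ∧ e)) (layer-order a c b))
                                               (drop-distinct a c _ (order-distinct a c))))
                      (count-above m (toℕ a))

  indeg-vertex : ∀ a b → indeg ordered (vertex a b) ≡ ind (0 <ᵇ toℕ b) + toℕ a
  indeg-vertex a b =
    trans (sum-cong (m * n) (λ w → cong (λ e → ind (e ∧ (toℕ w <ᵇ toℕ (vertex a b)))) (adj-sym KP w (vertex a b))))
          (trans (neighbour-sum a b (λ w → toℕ w <ᵇ toℕ (vertex a b))) (cong₂ _+_ columnPart layerPart))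
    where
    columnPart : sumFin n (λ d → ind (pathAdj b d ∧ (toℕ (vertex a d) <ᵇ toℕ (vertex a b)))) ≡ ind (0 <ᵇ toℕ b)
    columnPart = trans (sum-cong n (λ d → cong (λ e → ind (pathAdj b d ∧ e)) (column-order a d b))) (path-down b)
    layerPart : sumFin m (λ c → ind (not (a == c) ∧ (toℕ (vertex c b) <ᵇ toℕ (vertex a b)))) ≡ toℕ a
    layerPart = trans (sum-cong m (λ c → trans (cong (λ e → ind (not (a == c) ∧ e)) (layer-order c a b))
                                               (drop-distinct a c _ (λ c<a a≡c → order-distinct c a c<a (sym a≡c)))))
                      (count-below m (toℕ a) (<⇒≤ (FP.toℕ<n a)))

  -- The contribution max{0, d⁺ − d⁻} of the vertex with coordinates x, y.
  excess : ℕ → ℕ → ℕ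
  excess x y = (ind (suc y <ᵇ n) + (m ∸ suc x)) ∸ (ind (0 <ᵇ y) + x)

  cost-ordered : cost ordered ≡ rsum n (λ y → rsum m (λ x → excess x y))
  cost-ordered = begin
    cost ordered
      ≡⟨ sum-combine m n _ ⟩
    sumFin m (λ a → sumFin n (λ b → outdeg ordered (vertex a b) ∸ indeg ordered (vertex a b)))
      ≡⟨ sum-cong m (λ a → sum-cong n (λ b → cong₂ _∸_ (outdeg-vertex a b) (indeg-vertex a b))) ⟩
    sumFin m (λ a → sumFin n (λ b → excess (toℕ a) (toℕ b)))
      ≡⟨ sum-swap m n _ ⟩
    sumFin n (λ b → sumFin m (λ a → excess (toℕ a) (toℕ b)))
      ≡⟨ sum-cong n (λ b → sum-rsum m (λ x → excess x (toℕ b))) ⟩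
    sumFin n (λ b → rsum m (λ x → excess x (toℕ b)))
      ≡⟨ sum-rsum n (λ y → rsum m (λ x → excess x y)) ⟩
    rsum n (λ y → rsum m (λ x → excess x y)) ∎
    where open ≡-Reasoning

-- Σ_{x<k} max{0, t − 2x}, the total excess of one layer in the index orientation.
positiveParts : ℕ → ℕ → ℕ
positiveParts t k = rsum k (λ x → (t ∸ x) ∸ x)

∸-shift : ∀ t x → (suc t ∸ x) ∸ suc x ≡ (t ∸ x) ∸ x
∸-shift t x = trans (∸-+-assoc (suc t) x (suc x)) (trans (cong (suc t ∸_) (+-suc x x)) (sym (∸-+-assoc t x x)))

positiveParts-step : ∀ t k → positiveParts (suc (suc t)) (suc k) ≡ suc (suc t) + positiveParts t k
positiveParts-step t k = trans (rsum-shift k _) (cong (suc (suc t) +_) (rsum-cong k _ _ (λ x _ → ∸-shift t x)))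

positiveParts-even : ∀ j k → j ≤ k → positiveParts (j + j) k ≡ j * suc j
positiveParts-even zero    k       _         =
  trans (rsum-cong k _ (λ _ → 0) (λ x _ → trans (cong (_∸ x) (0∸n≡0 x)) (0∸n≡0 x))) (trans (rsum-const k 0) (*-zeroʳ k))
positiveParts-even (suc j) (suc k) (s≤s j≤k) = begin
  positiveParts (suc j + suc j) (suc k)       ≡⟨ cong (λ t → positiveParts (suc t) (suc k)) (+-suc j j) ⟩
  positiveParts (suc (suc (j + j))) (suc k)   ≡⟨ positiveParts-step (j + j) k ⟩
  suc (suc (j + j)) + positiveParts (j + j) k ≡⟨ cong (suc (suc (j + j)) +_) (positiveParts-even j k j≤k) ⟩
  suc (suc (j + j)) + j * suc j               ≡⟨ arithmetic j ⟩
  suc j * suc (suc j)                         ∎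
  where
  open ≡-Reasoning
  arithmetic : ∀ j → suc (suc (j + j)) + j * suc j ≡ suc j * suc (suc j)
  arithmetic = solve-∀

positiveParts-odd : ∀ j k → suc j ≤ k → positiveParts (suc (j + j)) k ≡ suc j * suc j
positiveParts-odd zero    (suc k) _         = trans (rsum-shift k _) (cong suc
  (trans (rsum-cong k _ (λ _ → 0) (λ x _ → cong (_∸ suc x) (0∸n≡0 x))) (trans (rsum-const k 0) (*-zeroʳ k))))
positiveParts-odd (suc j) (suc k) (s≤s j<k) = begin
  positiveParts (suc (suc j + suc j)) (suc k)
    ≡⟨ cong (λ t → positiveParts (suc (suc t)) (suc k)) (+-suc j j) ⟩
  positiveParts (suc (suc (suc (j + j)))) (suc k)
    ≡⟨ positiveParts-step (suc (j + j)) k ⟩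
  suc (suc (suc (j + j))) + positiveParts (suc (j + j)) k
    ≡⟨ cong (suc (suc (suc (j + j))) +_) (positiveParts-odd j k j<k) ⟩
  suc (suc (suc (j + j))) + suc j * suc j
    ≡⟨ arithmetic j ⟩
  suc (suc j) * suc (suc j) ∎
  where
  open ≡-Reasoning
  arithmetic : ∀ j → suc (suc (suc (j + j))) + suc j * suc j ≡ suc (suc j) * suc (suc j)
  arithmetic = solve-∀

-- For m = 2H and n ≥ 2 the index orientation costs n·H²: the
-- first layer contributes Σ_x max{0, 2H − 2x} = H(H+1), each of the n−2 middle
-- layers Σ_x max{0, 2H − 1 − 2x} = H², and the last layer
-- Σ_x max{0, 2H − 2 − 2x} = (H−1)H.
module UpperBound (h' n' : ℕ) where
  H m n : ℕ
  H = suc h'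
  m = H + H
  n = suc (suc n')
  open IndexDegrees m n public

  layerCost : ℕ → ℕ
  layerCost y = rsum m (λ x → excess x y)

  H≤m : H ≤ m
  H≤m = m≤m+n H H

  first-layer : layerCost 0 ≡ H * suc H
  first-layer = trans (rsum-cong m _ _ (λ x x<m → cong (_∸ x) (sym (+-∸-assoc 1 x<m))))
                      (positiveParts-even H m H≤m)

  middle-layer : ∀ k → k < n' → layerCost (suc k) ≡ H * H
  middle-layer k k<n' = trans (rsum-cong m _ (λ x → (suc (h' + h') ∸ x) ∸ x) middle)
                              (positiveParts-odd h' m H≤m)
    where
    middle : ∀ x → x < m → excess x (suc k) ≡ (suc (h' + h') ∸ x) ∸ x
    middle x _ = trans (cong (λ b → (ind b + (m ∸ suc x)) ∸ suc x) (<ᵇ-complete k<n'))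
                       (cong (λ t → (t ∸ x) ∸ x) (+-suc h' h'))

  last-layer : layerCost (suc n') ≡ h' * suc h'
  last-layer = trans (rsum-cong m _ (λ x → ((h' + h') ∸ x) ∸ x) last)
                     (positiveParts-even h' m (≤-trans (n≤1+n h') H≤m))
    where
    last : ∀ x → x < m → excess x (suc n') ≡ ((h' + h') ∸ x) ∸ x
    last x _ = trans (cong (λ b → (ind b + (m ∸ suc x)) ∸ suc x) (<ᵇ-false n' n' ≤-refl))
                     (trans (cong (λ t → (t ∸ x) ∸ suc x) (+-suc h' h')) (∸-shift (h' + h') x))

  cost-ordered-value : cost ordered ≡ n * (H * H)
  cost-ordered-value = begin
    cost ordered
      ≡⟨ cost-ordered ⟩
    rsum n layerCost
      ≡⟨ cong (_+ layerCost (suc n')) (rsum-shift n' layerCost) ⟩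
    layerCost 0 + rsum n' (λ k → layerCost (suc k)) + layerCost (suc n')
      ≡⟨ cong₂ (λ p q → p + q + layerCost (suc n')) first-layer (rsum-cong n' _ _ (λ k k<n' → middle-layer k k<n')) ⟩
    H * suc H + rsum n' (λ _ → H * H) + layerCost (suc n')
      ≡⟨ cong₂ (λ p q → H * suc H + p + q) (rsum-const n' (H * H)) last-layer ⟩
    H * suc H + n' * (H * H) + h' * suc h'
      ≡⟨ arithmetic h' n' ⟩
    n * (H * H) ∎
    where
    open ≡-Reasoning
    arithmetic : ∀ h' n' → suc h' * suc (suc h') + n' * (suc h' * suc h') + h' * suc h'
                             ≡ suc (suc n') * (suc h' * suc h')
    arithmetic = solve-∀

brush-number : ∀ h' n' → IsBrushNumber (K (suc h' + suc h') □ P (suc (suc n'))) (suc (suc n') * (suc h' * suc h'))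
brush-number h' n' =
  (ordered , indexOrientation-acyclic (K m □ P n) , cost-ordered-value) ,
  (λ o acyclic → LowerBound.lower-bound H n o acyclic)
  where open UpperBound h' n'

quarter-square : ∀ h → ((h + h) * (h + h)) / 4 ≡ h * h
quarter-square h = trans (cong (_/ 4) (fourfold h)) (m*n/n≡m (h * h) 4)
  where
  fourfold : ∀ h → (h + h) * (h + h) ≡ h * h * 4
  fourfold = solve-∀

mainTheorem4 : (m n : ℕ) → 2 ∣ m → 2 ≤ m → 2 ≤ n →
    IsBrushNumber (K m □ P n) (n * ((m * m) / 4))
mainTheorem4 m (suc (suc n')) (divides (suc h') m≡2H) _ _ =
  subst (λ k → IsBrushNumber (K k □ P n) (n * ((k * k) / 4))) (sym m≡H+H)
        (subst (IsBrushNumber (K (H + H) □ P n)) (cong (n *_) (sym (quarter-square H))) (brush-number h' n'))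
  where
  H n : ℕ
  H = suc h'
  n = suc (suc n')
  m≡H+H : m ≡ H + H
  m≡H+H = trans m≡2H (trans (*-comm H 2) (cong (H +_) (+-identityʳ H)))
mainTheorem4 m (suc (suc n')) (divides zero m≡0) 2≤m _ with () ← ≤-trans 2≤m (≤-reflexive m≡0)
mainTheorem4 m 0       _ _ ()
mainTheorem4 m 1       _ _ (s≤s ())
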